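{- For every integer $k\ge 3$, the complete graph $K_{10k}$ has no $(k,3)$-edge co-colouring.
   Context: A $(k,p)$-edge co-colouring of a graph $G$ is an assignment of one of $k$ colours to each edge of $G$ such that no $p$ pairwise disjoint edges (edges whose endpoint sets are pairwise disjoint) all receive the same colour. -}

module Defs where

open import Data.Nat using (ℕ; _*_)
open import Data.Fin using (Fin)
open import Data.Product using (Σ; _×_)
open import Relation.Binary.PropositionalEquality using (_≡_; _≢_)
open import Relation.Nullary using (¬_)

-- Vertices are Fin n; an edge is an unordered pair {u,v} with u ≢ v.
-- We represent the colouring as a function on ordered pairs of distinct
-- vertices that is symmetric, i.e. it depends only on the unordered edge.
record KEdgeColouring (n k : ℕ) : Set where
  field
    colour : (u v : Fin n) → u ≢ v → Fin k
    symm   : (u v : Fin n) (p : u ≢ v) (q : v ≢ u) → colour u v p ≡ colour v u q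

open KEdgeColouring public

AllDistinct6 : {n : ℕ} → Fin n → Fin n → Fin n → Fin n → Fin n → Fin n → Set
AllDistinct6 a b c d e f =
  (a ≢ b) × (a ≢ c) × (a ≢ d) × (a ≢ e) × (a ≢ f) ×
  (b ≢ c) × (b ≢ d) × (b ≢ e) × (b ≢ f) ×
  (c ≢ d) × (c ≢ e) × (c ≢ f) ×
  (d ≢ e) × (d ≢ f) ×
  (e ≢ f)

-- Three pairwise disjoint edges {a1,b1},{a2,b2},{a3,b3} of K_n all receiving
-- the same colour (pairwise disjoint edges = six pairwise distinct endpoints).
Monochromatic3Matching : {n k : ℕ} → KEdgeColouring n k → Set
Monochromatic3Matching {n} c =
  Σ (Fin n) λ a1 → Σ (Fin n) λ b1 → Σ (Fin n) λ a2 →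
  Σ (Fin n) λ b2 → Σ (Fin n) λ a3 → Σ (Fin n) λ b3 →
  Σ (AllDistinct6 a1 b1 a2 b2 a3 b3) λ d →
    let open Data.Product in
    (colour c a1 b1 (proj₁ d) ≡ colour c a2 b2 (proj₁ (proj₂ (proj₂ (proj₂ (proj₂ (proj₂ (proj₂ (proj₂ (proj₂ (proj₂ d)))))))))))
  × (colour c a1 b1 (proj₁ d) ≡ colour c a3 b3 (proj₂ (proj₂ (proj₂ (proj₂ (proj₂ (proj₂ (proj₂ (proj₂ (proj₂ (proj₂ (proj₂ (proj₂ (proj₂ (proj₂ d)))))))))))))))

IsCoColouring3 : {n k : ℕ} → KEdgeColouring n k → Set
IsCoColouring3 c = ¬ Monochromatic3Matching c

{-# OPTIONS --safe #-}
-- In a co-colouring no colour class contains three pairwise disjoint edges, so a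
-- greedy maximal matching of a class has at most two edges and its at most four
-- endpoints cover every edge of that colour. The union of these covers has at
-- most 4k vertices; when n ≥ 4k + 2 two vertices u, v lie outside it, and the
-- edge uv, whatever its colour, is not covered.
module Submission where

open import Defs
open import Data.Nat using (ℕ; _*_; _≥_; _+_; _≤_; _<_; z≤n; s≤s)
open import Data.Nat.Properties
  using (<⇒≱; ≤-refl; ≤-trans; ≤-reflexive; n≤1+n; m≤n*m; +-mono-≤; +-monoˡ-≤; +-monoʳ-≤; *-comm; *-distribʳ-+)
open import Function using (id; _∘_)
open import Data.Fin using (Fin)
open import Data.Fin.Properties using (_≟_; any?; ¬∀⟶∃¬; injective⇒≤)
open import Data.Product using (Σ; ∃; ∃₂; _×_; _,_; proj₁; proj₂)
open import Data.Sum as Sum using (_⊎_; inj₁; inj₂; [_,_]′)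
open import Data.Empty using (⊥-elim)
open import Data.List using (List; []; _∷_; length; lookup; concatMap; allFin)
open import Data.List.Properties using (length-++; length-tabulate)
open import Data.List.Relation.Unary.All using ([]; _∷_)
open import Data.List.Relation.Unary.All.Properties using (¬Any⇒All¬)
open import Data.List.Relation.Unary.Any using (here; there; index)
open import Data.List.Relation.Unary.Any.Properties using (lookup-index)
open import Data.List.Membership.Propositional using (_∈_; _∉_; lose)
open import Data.List.Membership.Propositional.Properties using (∈-concatMap⁺; ∈-allFin)
open import Relation.Nullary using (¬_; Dec; yes; no)
open import Relation.Binary.PropositionalEquality
  using (_≡_; _≢_; refl; sym; trans; cong; ≢-sym)

length-concatMap-≤ : ∀ {A B : Set} {m} (f : A → List B) → (∀ x → length (f x) ≤ m) →
                     ∀ xs → length (concatMap f xs) ≤ length xs * m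
length-concatMap-≤ f bound []       = z≤n
length-concatMap-≤ f bound (x ∷ xs) =
  ≤-trans (≤-reflexive (length-++ (f x)))
          (+-mono-≤ (bound x) (length-concatMap-≤ f bound xs))

module _ {n : ℕ} where
  open import Data.List.Membership.DecPropositional (_≟_ {n}) using (_∈?_)

  ∃∉ : (xs : List (Fin n)) → length xs < n → ∃ λ u → u ∉ xs
  ∃∉ xs xs<n = ¬∀⟶∃¬ n (_∈ xs) (_∈? xs) λ all∈ →
      <⇒≱ xs<n (injective⇒≤ (index-injective all∈))
    where
    index-injective : (all∈ : ∀ u → u ∈ xs) → ∀ {i j} → index (all∈ i) ≡ index (all∈ j) → i ≡ j
    index-injective all∈ {i} {j} eq =
      trans (lookup-index (all∈ i)) (trans (cong (lookup xs) eq) (sym (lookup-index (all∈ j))))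

  ∃₂-≢-∉ : (xs : List (Fin n)) → 2 + length xs ≤ n → ∃₂ λ u v → u ≢ v × u ∉ xs × v ∉ xs
  ∃₂-≢-∉ xs 2+|xs|≤n
    with u , u∉xs ← ∃∉ xs (≤-trans (n≤1+n _) 2+|xs|≤n)
    with v , v∉u∷xs ← ∃∉ (u ∷ xs) 2+|xs|≤n
    = u , v , ≢-sym (v∉u∷xs ∘ here) , u∉xs , v∉u∷xs ∘ there

  module _ {k : ℕ} (c : KEdgeColouring n k) where

    colour-irrelevant : ∀ u v (p q : u ≢ v) → colour c u v p ≡ colour c u v q
    colour-irrelevant u v p q = trans (symm c u v p (≢-sym p)) (symm c v u (≢-sym p) q)

    AvoidingEdge : Fin k → List (Fin n) → Fin n → Fin n → Set
    AvoidingEdge col S u v = Σ (u ≢ v) λ u≢v → colour c u v u≢v ≡ col × u ∉ S × v ∉ S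

    avoidingEdge? : ∀ col S u v → Dec (AvoidingEdge col S u v)
    avoidingEdge? col S u v with u ≟ v
    ... | yes u≡v = no λ (u≢v , _) → u≢v u≡v
    ... | no u≢v with colour c u v u≢v ≟ col | u ∈? S | v ∈? S
    ... | yes ≡col | no u∉S | no v∉S = yes (u≢v , ≡col , u∉S , v∉S)
    ... | no ≢col  | _      | _      = no λ (p , ≡col , _) → ≢col (trans (colour-irrelevant u v u≢v p) ≡col)
    ... | _        | yes u∈S | _     = no λ (_ , _ , u∉S , _) → u∉S u∈S
    ... | _        | _      | yes v∈S = no λ (_ , _ , _ , v∉S) → v∉S v∈S

    Covers : Fin k → List (Fin n) → Set
    Covers col S = ∀ u v (u≢v : u ≢ v) → colour c u v u≢v ≡ col → u ∈ S ⊎ v ∈ S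

    covers⊎avoidingEdge : ∀ col S → Covers col S ⊎ ∃ λ u → ∃ λ v → AvoidingEdge col S u v
    covers⊎avoidingEdge col S with any? (λ u → any? λ v → avoidingEdge? col S u v)
    ... | yes edge = inj₂ edge
    ... | no noEdge = inj₁ covered
      where
      covered : Covers col S
      covered u v u≢v ≡col with u ∈? S | v ∈? S
      ... | yes u∈S | _       = inj₁ u∈S
      ... | no _    | yes v∈S = inj₂ v∈S
      ... | no u∉S  | no v∉S  = ⊥-elim (noEdge (u , v , u≢v , ≡col , u∉S , v∉S))

    monochromatic3Matching : ∀ {col a b a′ b′ a″ b″} →
      AvoidingEdge col [] a b → AvoidingEdge col (a ∷ b ∷ []) a′ b′ →
      AvoidingEdge col (a ∷ b ∷ a′ ∷ b′ ∷ []) a″ b″ → Monochromatic3Matching c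
    monochromatic3Matching (a≢b , ≡col , _) (a′≢b′ , ≡col′ , a′∉ , b′∉) (a″≢b″ , ≡col″ , a″∉ , b″∉)
      with ¬Any⇒All¬ _ a′∉ | ¬Any⇒All¬ _ b′∉ | ¬Any⇒All¬ _ a″∉ | ¬Any⇒All¬ _ b″∉
    ... | a′≢a ∷ a′≢b ∷ [] | b′≢a ∷ b′≢b ∷ []
        | a″≢a ∷ a″≢b ∷ a″≢a′ ∷ a″≢b′ ∷ [] | b″≢a ∷ b″≢b ∷ b″≢a′ ∷ b″≢b′ ∷ [] =
      _ , _ , _ , _ , _ , _ ,
      ( a≢b , ≢-sym a′≢a , ≢-sym b′≢a , ≢-sym a″≢a , ≢-sym b″≢a
      , ≢-sym a′≢b , ≢-sym b′≢b , ≢-sym a″≢b , ≢-sym b″≢b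
      , a′≢b′ , ≢-sym a″≢a′ , ≢-sym b″≢a′
      , ≢-sym a″≢b′ , ≢-sym b″≢b′
      , a″≢b″ )
      , trans ≡col (sym ≡col′) , trans ≡col (sym ≡col″)

    module _ (no3 : IsCoColouring3 c) where

      smallCover : (col : Fin k) → Σ (List (Fin n)) λ S → length S ≤ 4 × Covers col S
      smallCover col with covers⊎avoidingEdge col []
      ... | inj₁ cov = _ , z≤n , cov
      ... | inj₂ (a , b , e₁) with covers⊎avoidingEdge col (a ∷ b ∷ [])
      ... | inj₁ cov = _ , s≤s (s≤s z≤n) , cov
      ... | inj₂ (a′ , b′ , e₂) with covers⊎avoidingEdge col (a ∷ b ∷ a′ ∷ b′ ∷ [])
      ... | inj₁ cov = _ , ≤-refl , cov
      ... | inj₂ (_ , _ , e₃) = ⊥-elim (no3 (monochromatic3Matching e₁ e₂ e₃))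

      cover : List (Fin n)
      cover = concatMap (λ col → proj₁ (smallCover col)) (allFin k)

      length-cover : length cover ≤ 4 * k
      length-cover =
        ≤-trans (length-concatMap-≤ _ (λ col → proj₁ (proj₂ (smallCover col))) (allFin k))
                (≤-reflexive (trans (cong (_* 4) (length-tabulate (id {A = Fin k}))) (*-comm k 4)))

      cover-covers : ∀ u v → u ≢ v → u ∈ cover ⊎ v ∈ cover
      cover-covers u v u≢v =
        Sum.map ∈-cover ∈-cover (proj₂ (proj₂ (smallCover (colour c u v u≢v))) u v u≢v refl)
        where
        ∈-cover : ∀ {col x} → x ∈ proj₁ (smallCover col) → x ∈ cover
        ∈-cover {col} x∈ = ∈-concatMap⁺ _ (lose (∈-allFin col) x∈)

    noCoColouring : 2 + 4 * k ≤ n → ¬ IsCoColouring3 c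
    noCoColouring 2+4k≤n no3
      with u , v , u≢v , u∉ , v∉ ← ∃₂-≢-∉ (cover no3) (≤-trans (+-monoʳ-≤ 2 (length-cover no3)) 2+4k≤n)
      = [ u∉ , v∉ ]′ (cover-covers no3 u v u≢v)

lemma5p18 : (k : ℕ) → k ≥ 3 →
    ¬ (Σ (KEdgeColouring (10 * k) k) λ c → IsCoColouring3 c)
lemma5p18 k k≥3 (c , no3) = noCoColouring c 2+4k≤10k no3
  where
  2≤6k : 2 ≤ 6 * k
  2≤6k = ≤-trans (≤-trans (n≤1+n 2) k≥3) (m≤n*m k 6)
  2+4k≤10k : 2 + 4 * k ≤ 10 * k
  2+4k≤10k = ≤-trans (+-monoˡ-≤ (4 * k) 2≤6k) (≤-reflexive (sym (*-distribʳ-+ k 6 4)))
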